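{- If a graph $G$ contains a vertex adjacent to all other vertices, then $\chi_i(G)=\chi(G)$.
   Context: All graphs are finite, simple, undirected and connected. Private neighbors. For $S\subseteq V(G)$ and $v\in S$, $pn[v,S]=N[v]\setminus \bigcup_{u\in S\setminus\{v\}}N[u]$, where $N[\cdot]$ is the closed neighborhood. Irredundance. $S$ is irredundant if $pn[v,S]\ne\emptyset$ for all $v\in S$. It is maximal irredundant if $S$ is irredundant and $S\cup\{w\}$ is not irredundant for all $w\notin S$. Colorings. $\chi(G)$ is the chromatic number. An irredundance coloring of $G$ is a proper coloring for which some maximal irredundant set has all its vertices colored pairwise differently. $\chi_i(G)$ is the minimum number of colors in an irredundance coloring. -}

module Defs where

open import Data.Nat using (ℕ; _≤_)
open import Data.Fin using (Fin)
open import Data.Fin.Subset using (Subset; _∈_; _∉_; _∪_; ⁅_⁆)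
open import Data.Bool using (Bool; true; false)
open import Data.Product using (Σ; ∃; _×_)
open import Data.Sum using (_⊎_)
open import Relation.Binary.PropositionalEquality using (_≡_; _≢_)
open import Relation.Nullary using (¬_)

record Graph : Set where
  field
    n     : ℕ
    adj   : Fin n → Fin n → Bool
    sym   : ∀ u v → adj u v ≡ adj v u
    irrefl : ∀ v → adj v v ≡ false

open Graph public

module _ (G : Graph) where

  InClosedNbhd : Fin (n G) → Fin (n G) → Set
  InClosedNbhd v u = u ≡ v ⊎ adj G v u ≡ true

  PrivateNeighbor : Fin (n G) → Subset (n G) → Fin (n G) → Set
  PrivateNeighbor v S w =
    InClosedNbhd v w × (∀ u → u ∈ S → u ≢ v → ¬ InClosedNbhd u w)

  Irredundant : Subset (n G) → Set
  Irredundant S = ∀ v → v ∈ S → ∃ λ w → PrivateNeighbor v S w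

  MaximalIrredundant : Subset (n G) → Set
  MaximalIrredundant S =
    Irredundant S × (∀ w → w ∉ S → ¬ Irredundant (S ∪ ⁅ w ⁆))

  ProperColoring : (k : ℕ) → (Fin (n G) → Fin k) → Set
  ProperColoring k c = ∀ u v → adj G u v ≡ true → c u ≢ c v

  IrredundanceColoring : (k : ℕ) → (Fin (n G) → Fin k) → Set
  IrredundanceColoring k c =
    ProperColoring k c ×
    (∃ λ S → MaximalIrredundant S ×
       (∀ u v → u ∈ S → v ∈ S → u ≢ v → c u ≢ c v))

  IsChromaticNumber : ℕ → Set
  IsChromaticNumber k =
    (∃ λ (c : Fin (n G) → Fin k) → ProperColoring k c) ×
    (∀ m (c : Fin (n G) → Fin m) → ProperColoring m c → k ≤ m)

  IsIrredundanceChromaticNumber : ℕ → Set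
  IsIrredundanceChromaticNumber k =
    (∃ λ (c : Fin (n G) → Fin k) → IrredundanceColoring k c) ×
    (∀ m (c : Fin (n G) → Fin m) → IrredundanceColoring m c → k ≤ m)

  HasUniversalVertex : Set
  HasUniversalVertex = ∃ λ v → ∀ u → u ≢ v → adj G v u ≡ true

{-# OPTIONS --safe #-}
-- A universal vertex v dominates G, so {v} is a maximal irredundant set: any
-- other vertex w added to it has all of N[w] inside N[v] = V(G), hence no
-- private neighbour. A singleton is rainbow under every colouring, so every
-- proper colouring is an irredundance colouring and χ_i(G) = χ(G).
module Submission where

open import Defs hiding (sym)
open import Data.Bool using (true)
open import Data.Nat using (ℕ)
open import Data.Fin using (Fin; _≟_)
open import Data.Fin.Subset using (Subset; _∈_; _∉_; _∪_; ⁅_⁆)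
open import Data.Fin.Subset.Properties using (x∈⁅x⁆; x∈⁅y⁆⇒x≡y; x∈p∪q⁺)
open import Data.Product using (_,_; proj₁)
open import Data.Sum using (inj₁; inj₂)
open import Relation.Binary.PropositionalEquality using (_≡_; _≢_; refl; sym; trans)
open import Relation.Nullary using (¬_; yes; no)

module _ (G : Graph) where

  Dominating : Fin (n G) → Set
  Dominating v = ∀ x → InClosedNbhd G v x

  Rainbow : {k : ℕ} → (Fin (n G) → Fin k) → Subset (n G) → Set
  Rainbow c S = ∀ u v → u ∈ S → v ∈ S → u ≢ v → c u ≢ c v

  universal⇒dominating : ∀ {v} → (∀ u → u ≢ v → adj G v u ≡ true) → Dominating v
  universal⇒dominating {v} univ x with x ≟ v
  ... | yes x≡v = inj₁ x≡v
  ... | no  x≢v = inj₂ (univ x x≢v)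

  ∈⁅v⁆⇒≡ : ∀ {v u u′ : Fin (n G)} → u ∈ ⁅ v ⁆ → u′ ∈ ⁅ v ⁆ → u ≡ u′
  ∈⁅v⁆⇒≡ {v} u∈ u′∈ = trans (x∈⁅y⁆⇒x≡y v u∈) (sym (x∈⁅y⁆⇒x≡y v u′∈))

  ⁅⁆-irredundant : ∀ v → Irredundant G ⁅ v ⁆
  ⁅⁆-irredundant v u u∈ = u , inj₁ refl , λ u′ u′∈ u′≢u _ → u′≢u (∈⁅v⁆⇒≡ u′∈ u∈)

  ⁅⁆-rainbow : ∀ {k} (c : Fin (n G) → Fin k) v → Rainbow c ⁅ v ⁆
  ⁅⁆-rainbow c v u u′ u∈ u′∈ u≢u′ _ = u≢u′ (∈⁅v⁆⇒≡ u∈ u′∈)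

  dominating⇒no-private-neighbour : ∀ {v w S} → Dominating v → v ∈ S → v ≢ w →
                                    ∀ x → ¬ PrivateNeighbor G w S x
  dominating⇒no-private-neighbour dom v∈S v≢w x (_ , excluded) = excluded _ v∈S v≢w (dom x)

  dominating⇒⁅⁆-maximalIrredundant : ∀ {v} → Dominating v → MaximalIrredundant G ⁅ v ⁆
  dominating⇒⁅⁆-maximalIrredundant {v} dom = ⁅⁆-irredundant v , extension-redundant
    where
    extension-redundant : ∀ w → w ∉ ⁅ v ⁆ → ¬ Irredundant G (⁅ v ⁆ ∪ ⁅ w ⁆)
    extension-redundant w w∉ irr with irr w (x∈p∪q⁺ (inj₂ (x∈⁅x⁆ w)))
    ... | x , pn = dominating⇒no-private-neighbour dom (x∈p∪q⁺ (inj₁ (x∈⁅x⁆ v))) v≢w x pn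
      where
      v≢w : v ≢ w
      v≢w refl = w∉ (x∈⁅x⁆ v)

  proper⇒irredundanceColoring : ∀ {S} → MaximalIrredundant G S →
    (∀ {k} (c : Fin (n G) → Fin k) → ProperColoring G k c → Rainbow c S) →
    ∀ {k} (c : Fin (n G) → Fin k) → ProperColoring G k c → IrredundanceColoring G k c
  proper⇒irredundanceColoring {S} maxIrr rainbow c proper =
    proper , S , maxIrr , rainbow c proper

  chromatic⇒irredundanceChromatic : ∀ {S} → MaximalIrredundant G S →
    (∀ {k} (c : Fin (n G) → Fin k) → ProperColoring G k c → Rainbow c S) →
    ∀ k → IsChromaticNumber G k → IsIrredundanceChromaticNumber G k
  chromatic⇒irredundanceChromatic maxIrr rainbow k ((c , proper) , minimal) =
    (c , proper⇒irredundanceColoring maxIrr rainbow c proper) ,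
    λ m c′ irrColoring → minimal m c′ (proj₁ irrColoring)

proposition2 : (G : Graph) → HasUniversalVertex G →
    (k : ℕ) → IsChromaticNumber G k → IsIrredundanceChromaticNumber G k
proposition2 G (v , univ) =
  chromatic⇒irredundanceChromatic G
    (dominating⇒⁅⁆-maximalIrredundant G (universal⇒dominating G univ))
    (λ c _ → ⁅⁆-rainbow G c v)
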